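{- Let $S(X)$ be a schematic extended Herbrand sequent $F[\bar x\backslash U_1],\bigvee_{i=1}^pX(\alpha,t_i)\to\bigwedge_{j=1}^mX(r_j,\beta_j)\vdash G[\bar y\backslash U_2]$, let $\psi$ be a maximal $\mathbf{G3c}$-derivation of its reduced representation, let $\mathcal A$ be a starting set with $\mathrm{Sol}(\mathcal A)\neq\emptyset$ (defined with respect to $\psi$), and let $\mathcal C\in\mathrm{Sol}(\mathcal A)$. Let $E=\mathrm{DNF}(\mathcal C)$ and $\hat E=\lambda xy.E$. Then $$F[\bar x\backslash U_1],\ \bigvee_{i=1}^p\hat E\alpha t_i\to\bigwedge_{j=1}^m\hat E r_j\beta_j\ \vdash\ G[\bar y\backslash U_2]$$ is a tautology.
   Context: Sequents are pairs of sets of formulas; $\mathbf{G3c}$ is the invertible cut-free sequent calculus for classical first-order logic. A $\mathbf{G3c}$-derivation of a sequent is a tree of sequents rooted at it in which each node is the conclusion of a $\mathbf{G3c}$ rule with its children as premises; it is maximal if no leaf is the conclusion of a rule (for quantifier-free sequents the leaves consist of atoms; a leaf is tautological iff some atom occurs on both sides). Setting: $F,G$ quantifier-free formulas, $\bar x=(x_1,\dots,x_k)$, $\bar y=(y_1,\dots,y_l)$, $\forall\bar xF\vdash\exists\bar yG$ provable, $h_F,h_G$ fresh function symbols of arities $k,l$. A Herbrand term set of this sequent is $\{h_F(\bar t_1),\dots,h_F(\bar t_{k'}),h_G(\bar t_{k'+1}),\dots,h_G(\bar t_n)\}$ where $F[\bar x\backslash\bar t_1],\dots,F[\bar x\backslash\bar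 t_{k'}]\vdash G[\bar y\backslash\bar t_{k'+1}],\dots,G[\bar y\backslash\bar t_n]$ is valid. A schematic $\Pi_2$-grammar has nonterminals $\tau,\alpha,\beta_1,\dots,\beta_m$ (ordered $\beta_1<\dots<\beta_m<\alpha<\tau$) and productions $\tau\to h_F(\bar u_1)\mid\dots\mid h_F(\bar u_N)\mid h_G(\bar v_1)\mid\dots\mid h_G(\bar v_M)$ with variables of $\bar u_i$ among $\{\alpha\}$ and of $\bar v_j$ among $\{\beta_1,\dots,\beta_m\}$; $\alpha\to r_1\mid\dots\mid r_m$ with $r_1$ variable-free and variables of $r_j$ among $\{\beta_1,\dots,\beta_{j-1}\}$; $\beta_j\to t_1[\alpha\backslash r_j]\mid\dots\mid t_p[\alpha\backslash r_j]$ for terms $t_1,\dots,t_p$ with variables among $\{\alpha\}$. Its language consists of the ground terms derivable from $\tau$ by rigid derivations (each nonterminal is rewritten by one and the same production throughout the derivation). If a Herbrand term set is contained in this language, $U_1=\{\bar u_1,\dots,\bar u_N\}$, $U_2=\{\bar v_1,\dots,\bar v_M\}$ and $X$ is a binary predicate variable, then $S(X):F[\bar x\backslash U_1],\bigvee_{i=1}^pX(\alpha,t_i)\to\bigwedge_{j=1}^mX(r_j,\beta_j)\vdash G[\bar y\backslash U_2]$ is a schematic extended Herbrand sequent (here $F[\bar x\backslash U]$ is the list of instances), and $R: F[\bar x\backslash U_1]\vdash G[\bar y\backslash U_2]$ is its reduced representation. For a formula $E$ in designated variables $x,y$, $\hat E=\lambda xy.E$, so $\hat E st=E[x\backslash s,y\backslash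 t]$. Leaves: for a sequent of atoms $P_1,\dots,P_i\vdash Q_1,\dots,Q_j$ put $D(\cdot)=\neg Q_1,\dots,\neg Q_j,P_1,\dots,P_i\vdash$; $\mathrm{DNTA}(\psi)=\{D(S'):S'$ a non-tautological leaf of $\psi\}$, each viewed as a set of literals. For $S\in\mathrm{DNTA}(\psi)$: $A(S)$ = literals containing $\alpha$; $B(S)$ = literals containing some $\beta_j$; $N(S)$ = literals containing neither $\alpha$ nor any $\beta_j$. $\overline L$ is the complementary literal and $\overline{M}=\{\overline L:L\in M\}$. A starting set is a finite set of finite sets of literals (clauses) with variables among $\{x,y\}$ not containing $\alpha,\beta_1,\dots,\beta_m$. For a finite set of clauses $\mathcal C$, $\mathrm{DNF}(\mathcal C)=\bigvee_{C\in\mathcal C}\bigwedge_{L\in C}L$. $\mathrm{Cl}(\mathcal A)$ is the set of $\mathcal C\subseteq\mathcal A$ such that for every $(C_1,\dots,C_m)\in\mathcal C^m$ and every $S\in\mathrm{DNTA}(\psi)$ at least one holds: ($T_1$) $\exists i\,\exists L\in C_i$: $L[x\backslash r_i]\in\overline{N(S)}$; ($T_2$) $\exists i\,\exists L\in C_i$: $L[x\backslash r_i,y\backslash\beta_i]\in\overline{B(S)}$; ($T_3$) $\exists i,j\,\exists L\in C_i\,\exists Q\in C_j$: $L[x\backslash r_i,y\backslash\beta_i]=\overline Q[x\backslash r_j,y\backslash\beta_j]$. $A'(S)$ = set of literals $L$ with variables among $\{x,y\}$ such that $L[x\backslash\alpha,y\backslash t_i]\in A(S)$ for some $i$; $I(S)$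 = set of subsets $M\subseteq A'(S)$ such that for some $i\in\{1,\dots,p\}$, $L[x\backslash\alpha,y\backslash t_i]\in A(S)$ for all $L\in M$. $\mathrm{Sol}(\mathcal A)$ is the set of $\mathcal C\in\mathrm{Cl}(\mathcal A)$ such that for every choice of literals $L_{C,i}\in C$ ($C\in\mathcal C$, $i\in\{1,\dots,p\}$) and every $S\in\mathrm{DNTA}(\psi)$ at least one holds: ($T'_1$) $\exists C\in\mathcal C\,\exists i$: $L_{C,i}[y\backslash t_i]\in N(S)$; ($T'_2$) $\exists C\in\mathcal C\,\exists I\in I(S)\,\forall i$: $L_{C,i}\in I$; ($T'_3$) $\exists C,D\in\mathcal C\,\exists i,j$: $L_{C,i}[x\backslash\alpha,y\backslash t_i]=\overline{L_{D,j}}[x\backslash\alpha,y\backslash t_j]$. -}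

module Defs where

open import Data.Nat using (ℕ; zero; suc; _<_)
open import Data.Fin using (Fin; toℕ) renaming (zero to fzero; suc to fsuc)
open import Data.List using (List; []; _∷_; _++_; map)
open import Data.List.Membership.Propositional using (_∈_)
open import Data.List.Relation.Unary.Any using (Any)
open import Data.List.Relation.Unary.All using (All)
open import Data.Vec as Vec using (Vec)
open import Data.Bool using (Bool; true; false; not) renaming (_∧_ to _&&_; _∨_ to _||_)
open import Data.Product using (Σ; ∃; ∃₂; _×_; _,_)
open import Data.Sum using (_⊎_)
open import Data.Empty using (⊥)
open import Relation.Nullary using (¬_)
open import Relation.Binary.PropositionalEquality using (_≡_; _≢_)

data Term (V : Set) : Set where
  var : V → Term V
  fn  : ℕ → List (Term V) → Term V

mutual
  substT : {V W : Set} → (V → Term W) → Term V → Term W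
  substT σ (var v)   = σ v
  substT σ (fn f ts) = fn f (substTs σ ts)

  substTs : {V W : Set} → (V → Term W) → List (Term V) → List (Term W)
  substTs σ []       = []
  substTs σ (t ∷ ts) = substT σ t ∷ substTs σ ts

data Occ {V : Set} (v : V) : Term V → Set where
  here : Occ v (var v)
  arg  : ∀ {f ts} → Any (Occ v) ts → Occ v (fn f ts)

VarsIn : {V : Set} → (V → Set) → Term V → Set
VarsIn P t = ∀ w → Occ w t → P w

Ground : {V : Set} → Term V → Set
Ground t = ∀ w → ¬ Occ w t

data Atm (V : Set) : Set where
  atm : ℕ → List (Term V) → Atm V

substA : {V W : Set} → (V → Term W) → Atm V → Atm W
substA σ (atm P ts) = atm P (substTs σ ts)

OccA : {V : Set} → V → Atm V → Set
OccA v (atm P ts) = Any (Occ v) ts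

data Lit (V : Set) : Set where
  pos : Atm V → Lit V
  neg : Atm V → Lit V

compl : {V : Set} → Lit V → Lit V
compl (pos a) = neg a
compl (neg a) = pos a

substL : {V W : Set} → (V → Term W) → Lit V → Lit W
substL σ (pos a) = pos (substA σ a)
substL σ (neg a) = neg (substA σ a)

OccL : {V : Set} → V → Lit V → Set
OccL v (pos a) = OccA v a
OccL v (neg a) = OccA v a

VarsInL : {V : Set} → (V → Set) → Lit V → Set
VarsInL P L = ∀ w → OccL w L → P w

data Fml (V : Set) : Set where
  Atom : Atm V → Fml V
  Top  : Fml V
  Bot  : Fml V
  Not  : Fml V → Fml V
  And  : Fml V → Fml V → Fml V
  Or   : Fml V → Fml V → Fml V
  Imp  : Fml V → Fml V → Fml V

substF : {V W : Set} → (V → Term W) → Fml V → Fml W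
substF σ (Atom a)  = Atom (substA σ a)
substF σ Top       = Top
substF σ Bot       = Bot
substF σ (Not A)   = Not (substF σ A)
substF σ (And A B) = And (substF σ A) (substF σ B)
substF σ (Or A B)  = Or (substF σ A) (substF σ B)
substF σ (Imp A B) = Imp (substF σ A) (substF σ B)

-- The global variable type: designated variables x, y (for the
-- formula E), the nonterminal α and the nonterminals β_{j+1} = vβ j.

data Var : Set where
  vx vy vα : Var
  vβ       : ℕ → Var

β : {m : ℕ} → Fin m → Term Var
β j = var (vβ (toℕ j))

α : Term Var
α = var vα

Fm : Set
Fm = Fml Var

sub2 : Term Var → Term Var → Var → Term Var
sub2 s t vx = s
sub2 s t vy = t
sub2 s t w  = var w

subx : Term Var → Var → Term Var
subx s vx = s
subx s w  = var w

suby : Term Var → Var → Term Var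
suby t vy = t
suby t w  = var w

subα : Term Var → Var → Term Var
subα s vα = s
subα s w  = var w

⟦_⟧ : Fm → (Atm Var → Bool) → Bool
⟦ Atom a ⟧ v  = v a
⟦ Top ⟧ v     = true
⟦ Bot ⟧ v     = false
⟦ Not A ⟧ v   = not (⟦ A ⟧ v)
⟦ And A B ⟧ v = ⟦ A ⟧ v && ⟦ B ⟧ v
⟦ Or A B ⟧ v  = ⟦ A ⟧ v || ⟦ B ⟧ v
⟦ Imp A B ⟧ v = not (⟦ A ⟧ v) || ⟦ B ⟧ v

Taut : List Fm → List Fm → Set
Taut Γ Δ = (v : Atm Var → Bool) → (∀ φ → φ ∈ Γ → ⟦ φ ⟧ v ≡ true) →
           ∃ λ φ → φ ∈ Δ × ⟦ φ ⟧ v ≡ true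

-- G3c-derivations on sequents of SETS of formulas (lists read as sets,
-- premises described up to set equality), maximal for quantifier-free
-- sequents: the leaves consist of atoms.

data Atomic : Fm → Set where
  atomic : ∀ {a} → Atomic (Atom a)

_≈ₛ_ : List Fm → (Fm → Set) → Set
Γ' ≈ₛ P = ∀ φ → (φ ∈ Γ' → P φ) × (P φ → φ ∈ Γ')

_∪_∖_ : List Fm → List Fm → Fm → Fm → Set
(new ∪ Γ ∖ A) φ = φ ∈ new ⊎ (φ ∈ Γ × φ ≢ A)

_∪_ : List Fm → List Fm → Fm → Set
(new ∪ Γ) φ = φ ∈ new ⊎ φ ∈ Γ

data Deriv : List Fm → List Fm → Set where
  leaf : ∀ {Γ Δ} → All Atomic Γ → All Atomic Δ → Deriv Γ Δ
  L∧ : ∀ {Γ Δ A B Γ'} → And A B ∈ Γ →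
       Γ' ≈ₛ ((A ∷ B ∷ []) ∪ Γ ∖ And A B) → Deriv Γ' Δ → Deriv Γ Δ
  R∧ : ∀ {Γ Δ A B Δ₁ Δ₂} → And A B ∈ Δ →
       Δ₁ ≈ₛ ((A ∷ []) ∪ Δ ∖ And A B) → Δ₂ ≈ₛ ((B ∷ []) ∪ Δ ∖ And A B) →
       Deriv Γ Δ₁ → Deriv Γ Δ₂ → Deriv Γ Δ
  L∨ : ∀ {Γ Δ A B Γ₁ Γ₂} → Or A B ∈ Γ →
       Γ₁ ≈ₛ ((A ∷ []) ∪ Γ ∖ Or A B) → Γ₂ ≈ₛ ((B ∷ []) ∪ Γ ∖ Or A B) →
       Deriv Γ₁ Δ → Deriv Γ₂ Δ → Deriv Γ Δ
  R∨ : ∀ {Γ Δ A B Δ'} → Or A B ∈ Δ →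
       Δ' ≈ₛ ((A ∷ B ∷ []) ∪ Δ ∖ Or A B) → Deriv Γ Δ' → Deriv Γ Δ
  L⇒ : ∀ {Γ Δ A B Γ₁ Δ₁ Γ₂} → Imp A B ∈ Γ →
       Γ₁ ≈ₛ ([] ∪ Γ ∖ Imp A B) → Δ₁ ≈ₛ ((A ∷ []) ∪ Δ) →
       Γ₂ ≈ₛ ((B ∷ []) ∪ Γ ∖ Imp A B) →
       Deriv Γ₁ Δ₁ → Deriv Γ₂ Δ → Deriv Γ Δ
  R⇒ : ∀ {Γ Δ A B Γ' Δ'} → Imp A B ∈ Δ →
       Γ' ≈ₛ ((A ∷ []) ∪ Γ) → Δ' ≈ₛ ((B ∷ []) ∪ Δ ∖ Imp A B) →
       Deriv Γ' Δ' → Deriv Γ Δ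
  L¬ : ∀ {Γ Δ A Γ' Δ'} → Not A ∈ Γ →
       Γ' ≈ₛ ([] ∪ Γ ∖ Not A) → Δ' ≈ₛ ((A ∷ []) ∪ Δ) →
       Deriv Γ' Δ' → Deriv Γ Δ
  R¬ : ∀ {Γ Δ A Γ' Δ'} → Not A ∈ Δ →
       Γ' ≈ₛ ((A ∷ []) ∪ Γ) → Δ' ≈ₛ ([] ∪ Δ ∖ Not A) →
       Deriv Γ' Δ' → Deriv Γ Δ

Leaf : ∀ {Γ Δ} → Deriv Γ Δ → List Fm → List Fm → Set
Leaf (leaf {Γ} {Δ} _ _) Γ₀ Δ₀       = (Γ₀ ≡ Γ) × (Δ₀ ≡ Δ)
Leaf (L∧ _ _ d) Γ₀ Δ₀               = Leaf d Γ₀ Δ₀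
Leaf (R∧ _ _ _ d e) Γ₀ Δ₀           = Leaf d Γ₀ Δ₀ ⊎ Leaf e Γ₀ Δ₀
Leaf (L∨ _ _ _ d e) Γ₀ Δ₀           = Leaf d Γ₀ Δ₀ ⊎ Leaf e Γ₀ Δ₀
Leaf (R∨ _ _ d) Γ₀ Δ₀               = Leaf d Γ₀ Δ₀
Leaf (L⇒ _ _ _ _ d e) Γ₀ Δ₀         = Leaf d Γ₀ Δ₀ ⊎ Leaf e Γ₀ Δ₀
Leaf (R⇒ _ _ _ d) Γ₀ Δ₀             = Leaf d Γ₀ Δ₀
Leaf (L¬ _ _ _ d) Γ₀ Δ₀             = Leaf d Γ₀ Δ₀
Leaf (R¬ _ _ _ d) Γ₀ Δ₀             = Leaf d Γ₀ Δ₀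

-- a leaf of atoms is tautological iff some atom occurs on both sides
NonTaut : List Fm → List Fm → Set
NonTaut Γ Δ = ∀ a → Atom a ∈ Γ → Atom a ∈ Δ → ⊥

-- S ∈ DNTA(ψ) is represented by the non-tautological leaf Γ ⊢ Δ of ψ;
-- membership of a literal in D(Γ ⊢ Δ) = ¬Δ, Γ ⊢ :
InD : List Fm → List Fm → Lit Var → Set
InD Γ Δ (pos a) = Atom a ∈ Γ
InD Γ Δ (neg a) = Atom a ∈ Δ

HasBeta : ℕ → Lit Var → Set
HasBeta m L = ∃ λ j → j < m × OccL (vβ j) L

InA : List Fm → List Fm → Lit Var → Set
InA Γ Δ L = InD Γ Δ L × OccL vα L

InB : ℕ → List Fm → List Fm → Lit Var → Set
InB m Γ Δ L = InD Γ Δ L × HasBeta m L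

InN : ℕ → List Fm → List Fm → Lit Var → Set
InN m Γ Δ L = InD Γ Δ L × ¬ OccL vα L × ¬ HasBeta m L

XY : Var → Set
XY w = (w ≡ vx) ⊎ (w ≡ vy)

InA' : {p : ℕ} → (Fin p → Term Var) → List Fm → List Fm → Lit Var → Set
InA' t Γ Δ L = VarsInL XY L × ∃ λ i → InA Γ Δ (substL (sub2 α (t i)) L)

InI : {p : ℕ} → (Fin p → Term Var) → List Fm → List Fm → List (Lit Var) → Set
InI t Γ Δ M = (∀ L → L ∈ M → InA' t Γ Δ L) ×
              ∃ λ i → ∀ L → L ∈ M → InA Γ Δ (substL (sub2 α (t i)) L)

Clause : Set
Clause = List (Lit Var)

StartingSet : List Clause → Set
StartingSet 𝒜 = ∀ C → C ∈ 𝒜 → ∀ L → L ∈ C → VarsInL XY L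

_⊆ᶜ_ : List Clause → List Clause → Set
𝒞 ⊆ᶜ 𝒜 = ∀ C → C ∈ 𝒞 → C ∈ 𝒜

InCl : {m p : ℕ} {Γ₀ Δ₀ : List Fm} → Deriv Γ₀ Δ₀ →
       (Fin m → Term Var) → (Fin p → Term Var) →
       List Clause → List Clause → Set
InCl {m} ψ r t 𝒜 𝒞 =
  𝒞 ⊆ᶜ 𝒜 ×
  ((Cs : Fin m → Clause) → (∀ i → Cs i ∈ 𝒞) →
   ∀ Γ Δ → Leaf ψ Γ Δ → NonTaut Γ Δ →
     (∃₂ λ i L → L ∈ Cs i × InN m Γ Δ (compl (substL (subx (r i)) L)))
   ⊎ (∃₂ λ i L → L ∈ Cs i × InB m Γ Δ (compl (substL (sub2 (r i) (β i)) L)))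
   ⊎ (∃₂ λ i j → ∃₂ λ L Q → L ∈ Cs i × Q ∈ Cs j ×
        substL (sub2 (r i) (β i)) L ≡ substL (sub2 (r j) (β j)) (compl Q)))

InSol : {m p : ℕ} {Γ₀ Δ₀ : List Fm} → Deriv Γ₀ Δ₀ →
        (Fin m → Term Var) → (Fin p → Term Var) →
        List Clause → List Clause → Set
InSol {m} {p} ψ r t 𝒜 𝒞 =
  InCl ψ r t 𝒜 𝒞 ×
  ((Lc : Clause → Fin p → Lit Var) → (∀ C → C ∈ 𝒞 → ∀ i → Lc C i ∈ C) →
   ∀ Γ Δ → Leaf ψ Γ Δ → NonTaut Γ Δ →
     (∃₂ λ C i → C ∈ 𝒞 × InN m Γ Δ (substL (suby (t i)) (Lc C i)))
   ⊎ (∃₂ λ C M → C ∈ 𝒞 × InI t Γ Δ M × (∀ i → Lc C i ∈ M))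
   ⊎ (∃₂ λ C D → ∃₂ λ i j → C ∈ 𝒞 × D ∈ 𝒞 ×
        substL (sub2 α (t i)) (Lc C i) ≡ substL (sub2 α (t j)) (compl (Lc D j))))

litF : Lit Var → Fm
litF (pos a) = Atom a
litF (neg a) = Not (Atom a)

conj : Clause → Fm
conj []       = Top
conj (L ∷ []) = litF L
conj (L ∷ Ls) = And (litF L) (conj Ls)

DNF : List Clause → Fm
DNF []       = Bot
DNF (C ∷ []) = conj C
DNF (C ∷ Cs) = Or (conj C) (DNF Cs)

Ê : Fm → Term Var → Term Var → Fm
Ê E s t = substF (sub2 s t) E

bigOr : (n : ℕ) → (Fin n → Fm) → Fm
bigOr zero f          = Bot
bigOr (suc zero) f    = f fzero
bigOr (suc (suc n)) f = Or (f fzero) (bigOr (suc n) (λ i → f (fsuc i)))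

bigAnd : (n : ℕ) → (Fin n → Fm) → Fm
bigAnd zero f          = Top
bigAnd (suc zero) f    = f fzero
bigAnd (suc (suc n)) f = And (f fzero) (bigAnd (suc n) (λ i → f (fsuc i)))

inst : {k : ℕ} → Fml (Fin k) → Vec (Term Var) k → Fm
inst F u = substF (Vec.lookup u) F

insts : {k : ℕ} → Fml (Fin k) → List (Vec (Term Var) k) → List Fm
insts F U = map (inst F) U

-- terms h_F(t̄), h_G(t̄) with fresh h_F, h_G
data HTerm (k l : ℕ) : Set where
  hF : Vec (Term Var) k → HTerm k l
  hG : Vec (Term Var) l → HTerm k l

hleft : {k l : ℕ} → Fml (Fin k) → List (HTerm k l) → List Fm
hleft F []          = []
hleft F (hF u ∷ H)  = inst F u ∷ hleft F H
hleft F (hG _ ∷ H)  = hleft F H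

hright : {k l : ℕ} → Fml (Fin l) → List (HTerm k l) → List Fm
hright G []         = []
hright G (hF _ ∷ H) = hright G H
hright G (hG v ∷ H) = inst G v ∷ hright G H

HerbrandTermSet : {k l : ℕ} → Fml (Fin k) → Fml (Fin l) → List (HTerm k l) → Set
HerbrandTermSet F G H = Taut (hleft F H) (hright G H)

-- side conditions of a schematic Π₂-grammar with
--   τ → h_F(ū) (ū ∈ U1) | h_G(v̄) (v̄ ∈ U2),  α → r_1 | … | r_m,
--   β_j → t_1[α\r_j] | … | t_p[α\r_j]
IsSchematicΠ₂Grammar : {k l m p : ℕ} →
  List (Vec (Term Var) k) → List (Vec (Term Var) l) →
  (Fin m → Term Var) → (Fin p → Term Var) → Set
IsSchematicΠ₂Grammar {m = m} U1 U2 r t =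
  (∀ u → u ∈ U1 → ∀ i → VarsIn (_≡ vα) (Vec.lookup u i)) ×
  (∀ v → v ∈ U2 → ∀ i → VarsIn (λ w → ∃ λ j → j < m × w ≡ vβ j) (Vec.lookup v i)) ×
  (∀ j → VarsIn (λ w → ∃ λ i → i < toℕ j × w ≡ vβ i) (r j)) ×
  (∀ i → VarsIn (_≡ vα) (t i))

-- s is in the language (rigid derivations from τ): one production is
-- chosen per nonterminal (α → r_a, β_j → t_{c j}[α\r_j]) and σ is the
-- resulting (ground) value of each nonterminal.
InLang : {k l m p : ℕ} →
  List (Vec (Term Var) k) → List (Vec (Term Var) l) →
  (Fin m → Term Var) → (Fin p → Term Var) → HTerm k l → Set
InLang {m = m} {p = p} U1 U2 r t s =
  Σ (Var → Term Var) λ σ → Σ (Fin m) λ a → Σ (Fin m → Fin p) λ c →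
    Ground (σ vα) × (∀ (j : Fin m) → Ground (σ (vβ (toℕ j)))) ×
    σ vα ≡ substT σ (r a) ×
    (∀ j → σ (vβ (toℕ j)) ≡ substT σ (substT (subα (r j)) (t (c j)))) ×
    ((∃ λ u → u ∈ U1 × s ≡ hF (Vec.map (substT σ) u)) ⊎
     (∃ λ v → v ∈ U2 × s ≡ hG (Vec.map (substT σ) v)))

IsSchematicExtHerbrand : {k l m p : ℕ} → Fml (Fin k) → Fml (Fin l) →
  List (Vec (Term Var) k) → List (Vec (Term Var) l) →
  (Fin m → Term Var) → (Fin p → Term Var) → Set
IsSchematicExtHerbrand F G U1 U2 r t =
  IsSchematicΠ₂Grammar U1 U2 r t ×
  ∃ λ H → HerbrandTermSet F G H × (∀ s → s ∈ H → InLang U1 U2 r t s)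

-- A valuation v refuting the sequent makes the antecedent true and the succedent false.
-- Following v through the invertible rules of ψ leads to a non-tautological leaf all of whose
-- literals v makes true; as the instances of F and G contain neither x nor y, neither do these
-- literals. If v falsified ⋁ᵢ Ê α tᵢ, picking in each clause of 𝒞 a literal falsified under
-- [x\α, y\tᵢ] would violate every alternative T'₁–T'₃ of Sol; if v satisfied ⋀ⱼ Ê rⱼ βⱼ,
-- picking for each j a clause of 𝒞 satisfied under [x\rⱼ, y\βⱼ] would violate every
-- alternative T₁–T₃ of Cl. So v would falsify the implication, which lies in the antecedent.
module Submission where

open import Defs
open import Data.Nat using (ℕ; zero; suc; _<_)
open import Data.Fin using (Fin)
open import Data.List using (List; []; _∷_; _++_)
open import Data.List.Membership.Propositional using (_∈_; find; lose)
open import Data.List.Membership.Propositional.Properties using (∈-map⁻; ∈-++⁺ˡ; ∈-++⁺ʳ)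
open import Data.List.Relation.Unary.All as All using (All; []; _∷_)
open import Data.List.Relation.Unary.Any as Any using (Any; here; there; any?)
open import Data.Vec as Vec using (Vec)
open import Data.Bool using (Bool; true; false; not; _≟_) renaming (_∧_ to _&&_; _∨_ to _||_)
open import Data.Bool.Properties using (not-involutive; not-¬; ¬-not)
open import Data.Product as Product using (∃; ∃₂; _×_; _,_; proj₁; proj₂)
open import Data.Sum as Sum using (_⊎_; inj₁; inj₂; [_,_]′)
open import Data.Unit using (⊤)
open import Data.Empty using (⊥; ⊥-elim)
open import Function using (_∘_; id)
open import Relation.Nullary using (¬_; yes; no)
open import Relation.Unary using (_⊆′_)
open import Relation.Binary.PropositionalEquality using (_≡_; refl; sym; trans; cong; cong₂; subst)

∧-true⁻ : ∀ {a b} → a && b ≡ true → a ≡ true × b ≡ true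
∧-true⁻ {true} e = refl , e

∧-false⁻ : ∀ {a b} → a && b ≡ false → a ≡ false ⊎ b ≡ false
∧-false⁻ {true}  e = inj₂ e
∧-false⁻ {false} e = inj₁ refl

∨-true⁻ : ∀ {a b} → a || b ≡ true → a ≡ true ⊎ b ≡ true
∨-true⁻ {true}  e = inj₁ refl
∨-true⁻ {false} e = inj₂ e

∨-false⁻ : ∀ {a b} → a || b ≡ false → a ≡ false × b ≡ false
∨-false⁻ {false} e = refl , e

not-true⁻ : ∀ {a} → not a ≡ true → a ≡ false
not-true⁻ {false} _ = refl

not-false⁻ : ∀ {a} → not a ≡ false → a ≡ true
not-false⁻ {true} _ = refl

module _ {V W : Set} {σ : V → Term W} where

  mutual
    substT-VarsIn : ∀ {Q : W → Set} → (∀ u → VarsIn Q (σ u)) → ∀ s → VarsIn Q (substT σ s)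
    substT-VarsIn hσ (var u)   = hσ u
    substT-VarsIn hσ (fn f ts) w (arg o) = substTs-VarsIn hσ ts w o

    substTs-VarsIn : ∀ {Q : W → Set} → (∀ u → VarsIn Q (σ u)) →
                     ∀ ts w → Any (Occ w) (substTs σ ts) → Q w
    substTs-VarsIn hσ (s ∷ ts) w (here o)  = substT-VarsIn hσ s w o
    substTs-VarsIn hσ (s ∷ ts) w (there o) = substTs-VarsIn hσ ts w o

  mutual
    Occ-substT⁺ : ∀ {u w s} → Occ u s → Occ w (σ u) → Occ w (substT σ s)
    Occ-substT⁺ here    o = o
    Occ-substT⁺ (arg a) o = arg (Occ-substTs⁺ a o)

    Occ-substTs⁺ : ∀ {u w ts} → Any (Occ u) ts → Occ w (σ u) → Any (Occ w) (substTs σ ts)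
    Occ-substTs⁺ (here a)  o = here (Occ-substT⁺ a o)
    Occ-substTs⁺ (there a) o = there (Occ-substTs⁺ a o)

  mutual
    substT-cong : ∀ {τ : V → Term W} s → (∀ u → Occ u s → σ u ≡ τ u) → substT σ s ≡ substT τ s
    substT-cong (var u)   agree = agree u here
    substT-cong (fn f ts) agree = cong (fn f) (substTs-cong ts (λ u → agree u ∘ arg))

    substTs-cong : ∀ {τ : V → Term W} ts → (∀ u → Any (Occ u) ts → σ u ≡ τ u) →
                   substTs σ ts ≡ substTs τ ts
    substTs-cong []       agree = refl
    substTs-cong (s ∷ ts) agree =
      cong₂ _∷_ (substT-cong s (λ u → agree u ∘ here)) (substTs-cong ts (λ u → agree u ∘ there))

OccL-compl : ∀ {V} {w : V} L → OccL w L → OccL w (compl L)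
OccL-compl (pos a) o = o
OccL-compl (neg a) o = o

substL-compl : ∀ {V W} (σ : V → Term W) L → substL σ (compl L) ≡ compl (substL σ L)
substL-compl σ (pos a) = refl
substL-compl σ (neg a) = refl

module _ {V W : Set} {σ τ : V → Term W} where

  substL-cong : ∀ L → (∀ u → OccL u L → σ u ≡ τ u) → substL σ L ≡ substL τ L
  substL-cong (pos (atm P ts)) agree = cong (pos ∘ atm P) (substTs-cong ts agree)
  substL-cong (neg (atm P ts)) agree = cong (neg ∘ atm P) (substTs-cong ts agree)

  OccL-substL⁺ : ∀ {u w} L → OccL u L → Occ w (σ u) → OccL w (substL σ L)
  OccL-substL⁺ (pos (atm P ts)) a o = Occ-substTs⁺ a o
  OccL-substL⁺ (neg (atm P ts)) a o = Occ-substTs⁺ a o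

  substL-cong-unless : ∀ {w} L → (∀ u → σ u ≡ τ u ⊎ σ u ≡ var w) →
                       ¬ OccL w (substL σ L) → substL σ L ≡ substL τ L
  substL-cong-unless {w} L agree w∉σL = substL-cong L λ u u∈L →
    [ id , (λ e → ⊥-elim (w∉σL (OccL-substL⁺ L u∈L (subst (Occ w) (sym e) here)))) ]′ (agree u)

NotXY : Var → Set
NotXY w = ¬ XY w

substL-suby≡sub2 : ∀ s L → VarsInL NotXY (substL (suby s) L) → substL (suby s) L ≡ substL (sub2 α s) L
substL-suby≡sub2 s L free = substL-cong-unless L agree (λ o → free vx o (inj₁ refl))
  where
  agree : ∀ u → suby s u ≡ sub2 α s u ⊎ suby s u ≡ var vx
  agree vx     = inj₂ refl
  agree vy     = inj₁ refl
  agree vα     = inj₁ refl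
  agree (vβ _) = inj₁ refl

substL-subx≡sub2 : ∀ s b L → VarsInL NotXY (substL (subx s) L) → substL (subx s) L ≡ substL (sub2 s b) L
substL-subx≡sub2 s b L free = substL-cong-unless L agree (λ o → free vy o (inj₂ refl))
  where
  agree : ∀ u → subx s u ≡ sub2 s b u ⊎ subx s u ≡ var vy
  agree vx     = inj₁ refl
  agree vy     = inj₂ refl
  agree vα     = inj₁ refl
  agree (vβ _) = inj₁ refl

AllAtoms : {V : Set} → (Atm V → Set) → Fml V → Set
AllAtoms P (Atom a)  = P a
AllAtoms P Top       = ⊤
AllAtoms P Bot       = ⊤
AllAtoms P (Not A)   = AllAtoms P A
AllAtoms P (And A B) = AllAtoms P A × AllAtoms P B
AllAtoms P (Or A B)  = AllAtoms P A × AllAtoms P B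
AllAtoms P (Imp A B) = AllAtoms P A × AllAtoms P B

VarsInA : {V : Set} → (V → Set) → Atm V → Set
VarsInA Q a = ∀ w → OccA w a → Q w

substF-AllAtoms-VarsIn : ∀ {V W} {Q : W → Set} {σ : V → Term W} →
                         (∀ u → VarsIn Q (σ u)) → ∀ φ → AllAtoms (VarsInA Q) (substF σ φ)
substF-AllAtoms-VarsIn hσ (Atom (atm P ts)) = substTs-VarsIn hσ ts
substF-AllAtoms-VarsIn hσ Top       = _
substF-AllAtoms-VarsIn hσ Bot       = _
substF-AllAtoms-VarsIn hσ (Not A)   = substF-AllAtoms-VarsIn hσ A
substF-AllAtoms-VarsIn hσ (And A B) = substF-AllAtoms-VarsIn hσ A , substF-AllAtoms-VarsIn hσ B
substF-AllAtoms-VarsIn hσ (Or A B)  = substF-AllAtoms-VarsIn hσ A , substF-AllAtoms-VarsIn hσ B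
substF-AllAtoms-VarsIn hσ (Imp A B) = substF-AllAtoms-VarsIn hσ A , substF-AllAtoms-VarsIn hσ B

insts-AllAtoms-NotXY : ∀ {k} {Q : Var → Set} → (∀ {w} → Q w → NotXY w) →
                       (F : Fml (Fin k)) (U : List (Vec (Term Var) k)) →
                       (∀ u → u ∈ U → ∀ i → VarsIn Q (Vec.lookup u i)) →
                       ∀ φ → φ ∈ insts F U → AllAtoms (VarsInA NotXY) φ
insts-AllAtoms-NotXY Q⇒NotXY F U hU φ φ∈ with ∈-map⁻ (inst F) φ∈
... | u , u∈U , refl = substF-AllAtoms-VarsIn (λ i w o → Q⇒NotXY (hU u u∈U i w o)) F

α-NotXY : ∀ {w} → w ≡ vα → NotXY w
α-NotXY refl (inj₁ ())
α-NotXY refl (inj₂ ())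

β-NotXY : ∀ {m w} → (∃ λ j → j < m × w ≡ vβ j) → NotXY w
β-NotXY (_ , _ , refl) (inj₁ ())
β-NotXY (_ , _ , refl) (inj₂ ())

record DownwardClosed (T F : Fm → Set) : Set where
  field
    T-and : ∀ {A B} → T (And A B) → T A × T B
    F-and : ∀ {A B} → F (And A B) → F A ⊎ F B
    T-or  : ∀ {A B} → T (Or A B) → T A ⊎ T B
    F-or  : ∀ {A B} → F (Or A B) → F A × F B
    T-imp : ∀ {A B} → T (Imp A B) → F A ⊎ T B
    F-imp : ∀ {A B} → F (Imp A B) → T A × F B
    T-not : ∀ {A} → T (Not A) → F A
    F-not : ∀ {A} → F (Not A) → T A

≈ₛ-∪∖-⊆ : ∀ {P : Fm → Set} {new Γ Γ' X} → Γ' ≈ₛ (new ∪ Γ ∖ X) →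
          All P new → (_∈ Γ) ⊆′ P → (_∈ Γ') ⊆′ P
≈ₛ-∪∖-⊆ eq P-new P-Γ φ φ∈ with proj₁ (eq φ) φ∈
... | inj₁ φ∈new      = All.lookup P-new φ∈new
... | inj₂ (φ∈Γ , _) = P-Γ φ φ∈Γ

≈ₛ-∪-⊆ : ∀ {P : Fm → Set} {new Γ Γ'} → Γ' ≈ₛ (new ∪ Γ) →
         All P new → (_∈ Γ) ⊆′ P → (_∈ Γ') ⊆′ P
≈ₛ-∪-⊆ eq P-new P-Γ φ φ∈ with proj₁ (eq φ) φ∈
... | inj₁ φ∈new = All.lookup P-new φ∈new
... | inj₂ φ∈Γ   = P-Γ φ φ∈Γ

module _ {T F : Fm → Set} (closed : DownwardClosed T F) where
  open DownwardClosed closed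

  record SignedLeaf {Γ Δ} (ψ : Deriv Γ Δ) : Set where
    constructor signed
    field
      {Γ₀ Δ₀} : List Fm
      isLeaf  : Leaf ψ Γ₀ Δ₀
      T-Γ₀    : (_∈ Γ₀) ⊆′ T
      F-Δ₀    : (_∈ Δ₀) ⊆′ F

  private
    via : ∀ {Γ Δ Γ' Δ'} {ψ : Deriv Γ Δ} {ψ' : Deriv Γ' Δ'} →
          (∀ {Γ₀ Δ₀} → Leaf ψ Γ₀ Δ₀ → Leaf ψ' Γ₀ Δ₀) → SignedLeaf ψ → SignedLeaf ψ'
    via f (signed isLeaf T-Γ₀ F-Δ₀) = signed (f isLeaf) T-Γ₀ F-Δ₀

  signed-leaf : ∀ {Γ Δ} (ψ : Deriv Γ Δ) → (_∈ Γ) ⊆′ T → (_∈ Δ) ⊆′ F → SignedLeaf ψ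
  signed-leaf (leaf _ _) T-Γ F-Δ = signed (refl , refl) T-Γ F-Δ
  signed-leaf (L∧ A∧B∈ eq d) T-Γ F-Δ =
    let tA , tB = T-and (T-Γ _ A∧B∈) in via id (signed-leaf d (≈ₛ-∪∖-⊆ eq (tA ∷ tB ∷ []) T-Γ) F-Δ)
  signed-leaf (R∧ A∧B∈ eq₁ eq₂ d₁ d₂) T-Γ F-Δ with F-and (F-Δ _ A∧B∈)
  ... | inj₁ fA = via inj₁ (signed-leaf d₁ T-Γ (≈ₛ-∪∖-⊆ eq₁ (fA ∷ []) F-Δ))
  ... | inj₂ fB = via inj₂ (signed-leaf d₂ T-Γ (≈ₛ-∪∖-⊆ eq₂ (fB ∷ []) F-Δ))
  signed-leaf (L∨ A∨B∈ eq₁ eq₂ d₁ d₂) T-Γ F-Δ with T-or (T-Γ _ A∨B∈)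
  ... | inj₁ tA = via inj₁ (signed-leaf d₁ (≈ₛ-∪∖-⊆ eq₁ (tA ∷ []) T-Γ) F-Δ)
  ... | inj₂ tB = via inj₂ (signed-leaf d₂ (≈ₛ-∪∖-⊆ eq₂ (tB ∷ []) T-Γ) F-Δ)
  signed-leaf (R∨ A∨B∈ eq d) T-Γ F-Δ =
    let fA , fB = F-or (F-Δ _ A∨B∈) in via id (signed-leaf d T-Γ (≈ₛ-∪∖-⊆ eq (fA ∷ fB ∷ []) F-Δ))
  signed-leaf (L⇒ A⇒B∈ eq₁ eq₁' eq₂ d₁ d₂) T-Γ F-Δ with T-imp (T-Γ _ A⇒B∈)
  ... | inj₁ fA = via inj₁ (signed-leaf d₁ (≈ₛ-∪∖-⊆ eq₁ [] T-Γ) (≈ₛ-∪-⊆ eq₁' (fA ∷ []) F-Δ))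
  ... | inj₂ tB = via inj₂ (signed-leaf d₂ (≈ₛ-∪∖-⊆ eq₂ (tB ∷ []) T-Γ) F-Δ)
  signed-leaf (R⇒ A⇒B∈ eqΓ eqΔ d) T-Γ F-Δ =
    let tA , fB = F-imp (F-Δ _ A⇒B∈)
    in via id (signed-leaf d (≈ₛ-∪-⊆ eqΓ (tA ∷ []) T-Γ) (≈ₛ-∪∖-⊆ eqΔ (fB ∷ []) F-Δ))
  signed-leaf (L¬ ¬A∈ eqΓ eqΔ d) T-Γ F-Δ =
    via id (signed-leaf d (≈ₛ-∪∖-⊆ eqΓ [] T-Γ) (≈ₛ-∪-⊆ eqΔ (T-not (T-Γ _ ¬A∈) ∷ []) F-Δ))
  signed-leaf (R¬ ¬A∈ eqΓ eqΔ d) T-Γ F-Δ =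
    via id (signed-leaf d (≈ₛ-∪-⊆ eqΓ (F-not (F-Δ _ ¬A∈) ∷ []) T-Γ) (≈ₛ-∪∖-⊆ eqΔ [] F-Δ))

truth-downwardClosed : (v : Atm Var → Bool) →
                       DownwardClosed (λ φ → ⟦ φ ⟧ v ≡ true) (λ φ → ⟦ φ ⟧ v ≡ false)
truth-downwardClosed v = record
  { T-and = ∧-true⁻
  ; F-and = ∧-false⁻
  ; T-or  = ∨-true⁻
  ; F-or  = ∨-false⁻
  ; T-imp = Sum.map₁ not-true⁻ ∘ ∨-true⁻
  ; F-imp = λ e → let a , b = ∨-false⁻ e in not-false⁻ a , b
  ; T-not = not-true⁻
  ; F-not = not-false⁻
  }

∩-AllAtoms : ∀ {T F : Fm → Set} (P : Atm Var → Set) → DownwardClosed T F →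
             DownwardClosed (λ φ → T φ × AllAtoms P φ) (λ φ → F φ × AllAtoms P φ)
∩-AllAtoms P closed = record
  { T-and = λ (t , pA , pB) → let tA , tB = T-and t in (tA , pA) , (tB , pB)
  ; F-and = λ (f , pA , pB) → Sum.map (_, pA) (_, pB) (F-and f)
  ; T-or  = λ (t , pA , pB) → Sum.map (_, pA) (_, pB) (T-or t)
  ; F-or  = λ (f , pA , pB) → let fA , fB = F-or f in (fA , pA) , (fB , pB)
  ; T-imp = λ (t , pA , pB) → Sum.map (_, pA) (_, pB) (T-imp t)
  ; F-imp = λ (f , pA , pB) → let tA , fB = F-imp f in (tA , pA) , (fB , pB)
  ; T-not = λ (t , pA) → T-not t , pA
  ; F-not = λ (f , pA) → F-not f , pA
  }
  where open DownwardClosed closed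

litval : (Atm Var → Bool) → Lit Var → Bool
litval v L = ⟦ litF L ⟧ v

litval-compl : ∀ v L → litval v (compl L) ≡ not (litval v L)
litval-compl v (pos a) = refl
litval-compl v (neg a) = sym (not-involutive (v a))

litval-compl-clash : ∀ v L {b} → litval v L ≡ b → litval v (compl L) ≡ b → ⊥
litval-compl-clash v L L≡b L̅≡b = not-¬ (trans (sym (litval-compl v L)) L̅≡b) (cong not L≡b)

litval-substL : ∀ v σ L → litval v (substL σ L) ≡ litval (v ∘ substA σ) L
litval-substL v σ (pos a) = refl
litval-substL v σ (neg a) = refl

⟦substF⟧ : ∀ v σ φ → ⟦ substF σ φ ⟧ v ≡ ⟦ φ ⟧ (v ∘ substA σ)
⟦substF⟧ v σ (Atom a)  = refl
⟦substF⟧ v σ Top       = refl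
⟦substF⟧ v σ Bot       = refl
⟦substF⟧ v σ (Not A)   = cong not (⟦substF⟧ v σ A)
⟦substF⟧ v σ (And A B) = cong₂ _&&_ (⟦substF⟧ v σ A) (⟦substF⟧ v σ B)
⟦substF⟧ v σ (Or A B)  = cong₂ _||_ (⟦substF⟧ v σ A) (⟦substF⟧ v σ B)
⟦substF⟧ v σ (Imp A B) = cong₂ (λ a b → not a || b) (⟦substF⟧ v σ A) (⟦substF⟧ v σ B)

module _ (v : Atm Var → Bool) where

  conj-true⁻ : ∀ C → ⟦ conj C ⟧ v ≡ true → All (λ L → litval v L ≡ true) C
  conj-true⁻ []            e = []
  conj-true⁻ (L ∷ [])      e = e ∷ []
  conj-true⁻ (L ∷ L' ∷ Ls) e = let eL , eLs = ∧-true⁻ e in eL ∷ conj-true⁻ (L' ∷ Ls) eLs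

  conj-false⁻ : ∀ C → ⟦ conj C ⟧ v ≡ false → Any (λ L → litval v L ≡ false) C
  conj-false⁻ (L ∷ [])      e = here e
  conj-false⁻ (L ∷ L' ∷ Ls) e = [ here , there ∘ conj-false⁻ (L' ∷ Ls) ]′ (∧-false⁻ e)

  DNF-true⁻ : ∀ 𝒞 → ⟦ DNF 𝒞 ⟧ v ≡ true → Any (λ C → ⟦ conj C ⟧ v ≡ true) 𝒞
  DNF-true⁻ (C ∷ [])      e = here e
  DNF-true⁻ (C ∷ C' ∷ 𝒞) e = [ here , there ∘ DNF-true⁻ (C' ∷ 𝒞) ]′ (∨-true⁻ e)

  DNF-false⁻ : ∀ 𝒞 → ⟦ DNF 𝒞 ⟧ v ≡ false → All (λ C → ⟦ conj C ⟧ v ≡ false) 𝒞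
  DNF-false⁻ []            e = []
  DNF-false⁻ (C ∷ [])      e = e ∷ []
  DNF-false⁻ (C ∷ C' ∷ 𝒞) e = let eC , e𝒞 = ∨-false⁻ e in eC ∷ DNF-false⁻ (C' ∷ 𝒞) e𝒞

  bigOr-false⁻ : ∀ n (f : Fin n → Fm) → ⟦ bigOr n f ⟧ v ≡ false → ∀ i → ⟦ f i ⟧ v ≡ false
  bigOr-false⁻ (suc zero)    f e Fin.zero    = e
  bigOr-false⁻ (suc (suc n)) f e Fin.zero    = proj₁ (∨-false⁻ e)
  bigOr-false⁻ (suc (suc n)) f e (Fin.suc i) = bigOr-false⁻ (suc n) (f ∘ Fin.suc) (proj₂ (∨-false⁻ e)) i

  bigAnd-true⁻ : ∀ n (f : Fin n → Fm) → ⟦ bigAnd n f ⟧ v ≡ true → ∀ i → ⟦ f i ⟧ v ≡ true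
  bigAnd-true⁻ (suc zero)    f e Fin.zero    = e
  bigAnd-true⁻ (suc (suc n)) f e Fin.zero    = proj₁ (∧-true⁻ e)
  bigAnd-true⁻ (suc (suc n)) f e (Fin.suc i) = bigAnd-true⁻ (suc n) (f ∘ Fin.suc) (proj₂ (∧-true⁻ e)) i

firstFalse : {A : Set} → (A → Bool) → A → List A → A
firstFalse f d [] = d
firstFalse f d (x ∷ xs) with f x
... | true  = firstFalse f d xs
... | false = x

firstFalse-spec : {A : Set} (f : A → Bool) (d : A) (xs : List A) →
                  Any (λ x → f x ≡ false) xs →
                  firstFalse f d xs ∈ xs × f (firstFalse f d xs) ≡ false
firstFalse-spec f d (x ∷ xs) found with f x in fx
... | false = here refl , fx
... | true with found
...   | here fx-false = ⊥-elim (not-¬ fx fx-false)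
...   | there found′  = Product.map₁ there (firstFalse-spec f d xs found′)

Realises : (Atm Var → Bool) → List Fm → List Fm → Set
Realises v Γ Δ = ∀ L → InD Γ Δ L → litval v L ≡ true × VarsInL NotXY L

Realises⇒NonTaut : ∀ {v Γ Δ} → Realises v Γ Δ → NonTaut Γ Δ
Realises⇒NonTaut real a a∈Γ a∈Δ = not-¬ (proj₁ (real (pos a) a∈Γ)) (not-true⁻ (proj₁ (real (neg a) a∈Δ)))

realised-leaf : ∀ v {Γ Δ} (ψ : Deriv Γ Δ) →
                (_∈ Γ) ⊆′ (λ φ → ⟦ φ ⟧ v ≡ true  × AllAtoms (VarsInA NotXY) φ) →
                (_∈ Δ) ⊆′ (λ φ → ⟦ φ ⟧ v ≡ false × AllAtoms (VarsInA NotXY) φ) →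
                ∃₂ λ Γ₀ Δ₀ → Leaf ψ Γ₀ Δ₀ × Realises v Γ₀ Δ₀
realised-leaf v ψ T-Γ F-Δ with signed-leaf (∩-AllAtoms _ (truth-downwardClosed v)) ψ T-Γ F-Δ
... | signed isLeaf T-Γ₀ F-Δ₀ = _ , _ , isLeaf , realises
  where
  realises : Realises v _ _
  realises (pos a) a∈Γ₀ = T-Γ₀ _ a∈Γ₀
  realises (neg a) a∈Δ₀ = let a-false , a-free = F-Δ₀ _ a∈Δ₀ in cong not a-false , a-free

module _ {m p : ℕ} {Γᵣ Δᵣ : List Fm} (ψ : Deriv Γᵣ Δᵣ)
         (r : Fin m → Term Var) (t : Fin p → Term Var) {𝒜 𝒞 : List Clause}
         (v : Atm Var → Bool) {Γ Δ : List Fm} (isLeaf : Leaf ψ Γ Δ) (real : Realises v Γ Δ) where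

  αt : Fin p → Var → Term Var
  αt i = sub2 α (t i)

  rβ : Fin m → Var → Term Var
  rβ j = sub2 (r j) (β j)

  Sol-refutes-falsified-choice :
    InSol ψ r t 𝒜 𝒞 → (Lc : Clause → Fin p → Lit Var) →
    (∀ C → C ∈ 𝒞 → ∀ i → Lc C i ∈ C) →
    (∀ C → C ∈ 𝒞 → ∀ i → litval v (substL (αt i) (Lc C i)) ≡ false) → ⊥
  Sol-refutes-falsified-choice (_ , sol) Lc Lc∈ Lc-false
    with sol Lc Lc∈ Γ Δ isLeaf (Realises⇒NonTaut real)
  ... | inj₁ (C , i , C∈𝒞 , L∈D , _) =
    let L-true , L-free = real _ L∈D
    in not-¬ (subst (λ L → litval v L ≡ true) (substL-suby≡sub2 (t i) (Lc C i) L-free) L-true)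
             (Lc-false C C∈𝒞 i)
  ... | inj₂ (inj₁ (C , M , C∈𝒞 , (_ , i , M⊆A) , Lc∈M)) =
    not-¬ (proj₁ (real _ (proj₁ (M⊆A (Lc C i) (Lc∈M i))))) (Lc-false C C∈𝒞 i)
  ... | inj₂ (inj₂ (C , D , i , j , C∈𝒞 , D∈𝒞 , eq)) =
    litval-compl-clash v (substL (αt j) (Lc D j)) (Lc-false D D∈𝒞 j)
      (subst (λ L → litval v L ≡ false) (trans eq (substL-compl (αt j) (Lc D j))) (Lc-false C C∈𝒞 i))

  Cl-refutes-satisfied-choice :
    InCl ψ r t 𝒜 𝒞 → (Cs : Fin m → Clause) → (∀ j → Cs j ∈ 𝒞) →
    (∀ j L → L ∈ Cs j → litval v (substL (rβ j) L) ≡ true) → ⊥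
  Cl-refutes-satisfied-choice (_ , cl) Cs Cs∈ Cs-true
    with cl Cs Cs∈ Γ Δ isLeaf (Realises⇒NonTaut real)
  ... | inj₁ (i , L , L∈ , L̅∈D , _) =
    let L̅-true , L̅-free = real _ L̅∈D
        same = substL-subx≡sub2 (r i) (β i) L (λ w → L̅-free w ∘ OccL-compl (substL (subx (r i)) L))
    in litval-compl-clash v (substL (rβ i) L) (Cs-true i L L∈)
         (subst (λ L′ → litval v (compl L′) ≡ true) same L̅-true)
  ... | inj₂ (inj₁ (i , L , L∈ , L̅∈D , _)) =
    litval-compl-clash v (substL (rβ i) L) (Cs-true i L L∈) (proj₁ (real _ L̅∈D))
  ... | inj₂ (inj₂ (i , j , L , Q , L∈ , Q∈ , eq)) =
    litval-compl-clash v (substL (rβ j) Q) (Cs-true j Q Q∈)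
      (subst (λ L′ → litval v L′ ≡ true) (trans eq (substL-compl (rβ j) Q)) (Cs-true i L L∈))

  Sol⇒antecedent-true : InSol ψ r t 𝒜 𝒞 → ⟦ bigOr p (λ i → Ê (DNF 𝒞) α (t i)) ⟧ v ≡ true
  Sol⇒antecedent-true 𝒞∈Sol = ¬-not λ antecedent-false →
    let falsified : ∀ i {C} → C ∈ 𝒞 → Any (λ L → litval v (substL (αt i) L) ≡ false) C
        falsified i C∈𝒞 =
          Any.map (λ {L} → trans (litval-substL v (αt i) L))
            (conj-false⁻ _ _ (All.lookup (DNF-false⁻ _ 𝒞 (trans (sym (⟦substF⟧ v (αt i) (DNF 𝒞)))
                                                             (bigOr-false⁻ v p _ antecedent-false i)))
                                         C∈𝒞))
        -- the default literal is only returned for clauses outside 𝒞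
        Lc : Clause → Fin p → Lit Var
        Lc C i = firstFalse (litval v ∘ substL (αt i)) (pos (atm 0 [])) C
        Lc-spec : ∀ C → C ∈ 𝒞 → ∀ i → Lc C i ∈ C × litval v (substL (αt i) (Lc C i)) ≡ false
        Lc-spec C C∈𝒞 i = firstFalse-spec (litval v ∘ substL (αt i)) _ C (falsified i C∈𝒞)
    in Sol-refutes-falsified-choice 𝒞∈Sol Lc
         (λ C C∈𝒞 i → proj₁ (Lc-spec C C∈𝒞 i)) (λ C C∈𝒞 i → proj₂ (Lc-spec C C∈𝒞 i))

  Cl⇒consequent-false : InCl ψ r t 𝒜 𝒞 → ⟦ bigAnd m (λ j → Ê (DNF 𝒞) (r j) (β j)) ⟧ v ≡ false
  Cl⇒consequent-false 𝒞∈Cl = ¬-not λ consequent-true →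
    let satisfied : ∀ j → ∃ λ C → C ∈ 𝒞 × ⟦ conj C ⟧ (v ∘ substA (rβ j)) ≡ true
        satisfied j = find (DNF-true⁻ _ 𝒞 (trans (sym (⟦substF⟧ v (rβ j) (DNF 𝒞)))
                                                (bigAnd-true⁻ v m _ consequent-true j)))
        Cs : Fin m → Clause
        Cs j = proj₁ (satisfied j)
    in Cl-refutes-satisfied-choice 𝒞∈Cl Cs (λ j → proj₁ (proj₂ (satisfied j)))
         (λ j L L∈ → trans (litval-substL v (rβ j) L)
                           (All.lookup (conj-true⁻ _ (Cs j) (proj₂ (proj₂ (satisfied j)))) L∈))

theorem3 : {k l m p : ℕ}
    (F : Fml (Fin k)) (G : Fml (Fin l))
    (U1 : List (Vec (Term Var) k)) (U2 : List (Vec (Term Var) l))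
    (r : Fin m → Term Var) (t : Fin p → Term Var) →
    IsSchematicExtHerbrand F G U1 U2 r t →
    (ψ : Deriv (insts F U1) (insts G U2)) →
    (𝒜 : List Clause) → StartingSet 𝒜 →
    (∃ λ 𝒞₀ → InSol ψ r t 𝒜 𝒞₀) →
    (𝒞 : List Clause) → InSol ψ r t 𝒜 𝒞 →
    Taut (insts F U1 ++
            (Imp (bigOr p (λ i → Ê (DNF 𝒞) α (t i)))
                 (bigAnd m (λ j → Ê (DNF 𝒞) (r j) (β j))) ∷ []))
         (insts G U2)
theorem3 F G U1 U2 r t ((U1-in-α , U2-in-β , _) , _) ψ 𝒜 _ _ 𝒞 𝒞∈Sol v ⊨Γ
  with any? (λ φ → ⟦ φ ⟧ v ≟ true) (insts G U2)
... | yes some-true = find some-true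
... | no  none-true with realised-leaf v ψ
      (λ φ φ∈ → ⊨Γ φ (∈-++⁺ˡ φ∈) , insts-AllAtoms-NotXY α-NotXY F U1 U1-in-α φ φ∈)
      (λ φ φ∈ → ¬-not (none-true ∘ lose φ∈) , insts-AllAtoms-NotXY β-NotXY G U2 U2-in-β φ φ∈)
...   | _ , _ , isLeaf , real =
  ⊥-elim (not-¬ (⊨Γ _ (∈-++⁺ʳ (insts F U1) (here refl)))
                (cong₂ (λ a c → not a || c)
                       (Sol⇒antecedent-true ψ r t v isLeaf real 𝒞∈Sol)
                       (Cl⇒consequent-false ψ r t v isLeaf real (proj₁ 𝒞∈Sol))))
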